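{- Let $A\in\mathcal{A}_{n,1}$ and let $(k;a_1,\dots,a_n;b,\beta)$ be the generalized inversion table of $\Lambda(A)$. Then $(k;a_1,\dots,a_n;b,\beta')$, where $\beta'=b-\beta+a_k-a_{k-1}-1$, is the generalized inversion table of $\Lambda(A')$.
   Context: An alternating sign matrix (ASM) of order $n$ is an $n\times n$ matrix with entries in $\{1,0,-1\}$ such that in every row and every column the nonzero entries alternate in sign, beginning and ending with $1$. Rows numbered top to bottom, columns left to right; "below" = larger row index. $\mathcal{A}_{n,1}$: order-$n$ ASMs with exactly one $-1$; $\overline{A}=(a_{u,n+1-v})$ is the vertical reflection of $A=(a_{uv})$. For $A\in\mathcal{A}_{n,1}$: opening column = column of the $-1$; opening row = row of the highest $1$ in the opening column; closing row = row of the $-1$. Left/right side: columns strictly left/right of the opening column. The closing row has exactly two $1$'s, one on each side; the right one is the closing $1$, its column the closing column. Enclosed rows: strictly between opening and closing rows. $A$ neutral if none; otherwise positive (resp. negative) if the $1$ of the lowest enclosed row is in the right (resp. left) side; sets $\mathcal{A}_{n,1}^{+},\mathcal{A}_{n,1}^{0},\mathcal{A}_{n,1}^{ - }$. For $A\in\mathcal{A}_{n,1}^{+}\cup\mathcal{A}_{n,1}^{0}$: charged cell = enclosed rows $\times$ right side; extended neutral cell = rows from opening to closing row inclusive $\times$ left side; leading $1$ = highest $1$ of left side strictly below the opening row, leading column its column; $\ell(A)$ = sum of entries strictly below the opening row strictly between leading and opening columns; $c(A)$ = sum of entries strictly below the closing row strictly between opening and closing columns; extended closing cell = entries strictly below the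 closing row in columns from opening to closing column inclusive. $E(A)$ = sum of the charged cell if positive, $0$ if neutral, $-E(\overline{A})$ if negative. $H$, $V$: for an $m\times p$ $(0,1)$-matrix $Q$ with nonzero columns $j_1=1<\dots<j_t<p$, $H(Q)$ moves column $j_i$ to $j_{i+1}$ ($j_{t+1}=p$) and zeroes column 1; for $Q$ with zero first row and nonzero last row, nonzero rows $i_1<\dots<i_t=m$, $V(Q)$ moves row $i_s$ to $i_{s-1}$ ($i_0=1$) and zeroes row $m$. For $A\in\mathcal{A}_{n,1}^{+}\cup\mathcal{A}_{n,1}^{0}$, $\delta(A)$: (1) replace the $-1$ and closing $1$ by $0$; (2) apply $H$ to the extended closing cell; (3) apply $V$ to the extended neutral cell; (4) move every $1$ of the extended neutral cell and charged cell down one row in its column (vacated positions become $0$); cells refer to positions in $A$. $\Delta(A)=(k,\delta(A),c(A),E(A))$, $k$ the opening row index; $\Delta$ is injective and if $\Delta(A)=(k,P,c,E)$ there is a unique $N\in\mathcal{A}_{n,1}^{0}$ with $\Delta(N)=(k,P,c+E,0)$. $\Lambda$: for $A\in\mathcal{A}_{n,1}^{+}\cup\mathcal{A}_{n,1}^{0}$ with $\Delta(A)=(k,P,c,E)$, $\Lambda(A)=(N,E)$ with $N\in\mathcal{A}_{n,1}^{0}$, $\Delta(N)=(k,P,c+E,0)$; for $A$ negative, if $\Lambda(\overline{A})=(M,F)$ then $\Lambda(A)=(\overline{M},-F)$. $\Lambda$ is a bijection from $\mathcal{A}_{n,1}$ onto $\mathcal{N}_{n,1}=\{(N,E): N\in\mathcal{A}_{n,1}^{0},\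 E\in\mathbb{Z},\ -\ell(N)\le E\le c(N)\}$. For $A\in\mathcal{A}_{n,1}$ with $\Lambda(A)=(N,E)$, define $A'=\Lambda^{ -1}(N,c(N)-\ell(N)-E)$. Generalized inversion table of $(N,E)\in\mathcal{N}_{n,1}$: with $n+1-k$ the opening row index of $N$, $a_i$ ($1\le i\le n$) is the sum of entries of $N$ strictly below row $n+1-i$ and strictly left of the unique $1$ of that row (leftmost $1$ if $i=k-1$); $b=c(N)$, $\beta=E+\ell(N)$; the table is $(k;a_1,\dots,a_n;b,\beta)$. -}

module Defs where

open import Data.Nat using (ℕ; zero; suc; _∸_; _≡ᵇ_; _<ᵇ_; _≤ᵇ_)
open import Data.Integer using (ℤ; 0ℤ; 1ℤ; -1ℤ; _+_; -_; _≟_)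
open import Data.Bool using (Bool; true; false; if_then_else_; _∧_; _∨_; not)
open import Data.List as List using (List; []; _∷_; applyUpTo; filter; reverse; concatMap; length; foldr)
open import Data.Bool.ListAction using (any)
open import Data.Vec as Vec using (Vec; tabulate; lookup; replicate; toList)
open import Data.Fin using (Fin; toℕ)
open import Data.Product using (_×_; _,_)
open import Data.Sum using (_⊎_)
open import Relation.Nullary using (¬?)
open import Relation.Nullary.Decidable using (⌊_⌋)
open import Relation.Binary.PropositionalEquality using (_≡_)

-- Basic conventions: an n×n integer matrix is a Vec of n rows.
-- All positions below are 1-based natural numbers (row r, column j);
-- out-of-range positions read as 0.

Mat : ℕ → Set
Mat n = Vec (Vec ℤ n) n

vget : ∀ {A : Set} {n} → A → Vec A n → ℕ → A
vget d Vec.[] _ = d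
vget d (x Vec.∷ xs) zero = x
vget d (x Vec.∷ xs) (suc k) = vget d xs k

ent : ∀ {n} → Mat n → ℕ → ℕ → ℤ
ent M zero _ = 0ℤ
ent M (suc r) zero = 0ℤ
ent {n} M (suc r) (suc j) = vget 0ℤ (vget (replicate n 0ℤ) M r) j

mk : ∀ n → (ℕ → ℕ → ℤ) → Mat n
mk n f = tabulate (λ i → tabulate (λ j → f (suc (toℕ i)) (suc (toℕ j))))

rng : ℕ → ℕ → List ℕ
rng lo hi = applyUpTo (lo Data.Nat.+_) (suc hi ∸ lo)

Σℤ : List ℤ → ℤ
Σℤ = foldr _+_ 0ℤ

boxSum : ∀ {n} → Mat n → ℕ → ℕ → ℕ → ℕ → ℤ
boxSum M r1 r2 c1 c2 = Σℤ (concatMap (λ r → List.map (λ j → ent M r j) (rng c1 c2)) (rng r1 r2))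

_==_ : ℤ → ℤ → Bool
x == y = ⌊ x ≟ y ⌋

-- first element of the list satisfying p (0 if none)
firstℕ : (ℕ → Bool) → List ℕ → ℕ
firstℕ p [] = 0
firstℕ p (x ∷ xs) = if p x then x else firstℕ p xs

lastℕ : (ℕ → Bool) → List ℕ → ℕ
lastℕ p xs = firstℕ p (reverse xs)

data Alt : List ℤ → Set where
  alt-one  : Alt (1ℤ ∷ [])
  alt-more : ∀ {xs} → Alt xs → Alt (1ℤ ∷ -1ℤ ∷ xs)

nonzeros : List ℤ → List ℤ
nonzeros = filter (λ x → ¬? (x ≟ 0ℤ))

IsASM : ∀ {n} → Mat n → Set
IsASM {n} M =
  ((i j : Fin n) → let x = lookup (lookup M i) j in (x ≡ 1ℤ) ⊎ (x ≡ 0ℤ) ⊎ (x ≡ -1ℤ))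
  × ((i : Fin n) → Alt (nonzeros (toList (lookup M i))))
  × ((j : Fin n) → Alt (nonzeros (toList (Vec.map (λ row → lookup row j) M))))

countMinus : ∀ {n} → Mat n → ℕ
countMinus M = length (filter (λ x → x ≟ -1ℤ) (concatMap toList (toList M)))

InA : ∀ {n} → Mat n → Set
InA M = IsASM M × countMinus M ≡ 1

module _ {n : ℕ} (M : Mat n) where
  closeRow : ℕ
  closeRow = firstℕ (λ r → any (λ j → ent M r j == -1ℤ) (rng 1 n)) (rng 1 n)

  openCol : ℕ
  openCol = firstℕ (λ j → ent M closeRow j == -1ℤ) (rng 1 n)

  openRow : ℕ
  openRow = firstℕ (λ r → ent M r openCol == 1ℤ) (rng 1 n)

  closeCol : ℕ
  closeCol = firstℕ (λ j → ent M closeRow j == 1ℤ) (rng (suc openCol) n)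

  oneCol : ℕ → ℕ
  oneCol r = firstℕ (λ j → ent M r j == 1ℤ) (rng 1 n)

data Sign : Set where
  pos neu neg : Sign

module _ {n : ℕ} (M : Mat n) where
  -- neutral iff no enclosed rows; otherwise positive/negative according to
  -- the side of the 1 of the lowest enclosed row (row closeRow - 1)
  sign : Sign
  sign = if closeRow M ≤ᵇ suc (openRow M) then neu
         else (if openCol M <ᵇ oneCol M (closeRow M ∸ 1) then pos else neg)

  chargedSum : ℤ
  chargedSum = boxSum M (suc (openRow M)) (closeRow M ∸ 1) (suc (openCol M)) n

  leadRow : ℕ
  leadRow = firstℕ (λ r → any (λ j → ent M r j == 1ℤ) (rng 1 (openCol M ∸ 1)))
                   (rng (suc (openRow M)) n)

  leadCol : ℕ
  leadCol = firstℕ (λ j → ent M leadRow j == 1ℤ) (rng 1 (openCol M ∸ 1))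

  ℓval : ℤ
  ℓval = boxSum M (suc (openRow M)) n (suc leadCol) (openCol M ∸ 1)

  cval : ℤ
  cval = boxSum M (suc (closeRow M)) n (suc (openCol M)) (closeCol M ∸ 1)

reflect : ∀ {n} → Mat n → Mat n
reflect {n} M = mk n (λ r j → ent M r (suc n ∸ j))

Enn : ∀ {n} → Mat n → ℤ
Enn M with sign M
... | pos = chargedSum M
... | _   = 0ℤ

Eval : ∀ {n} → Mat n → ℤ
Eval M with sign M
... | neg = - Enn (reflect M)
... | _   = Enn M

δ : ∀ {n} → Mat n → Mat n
δ {n} A = mk n f4
  where
  or = openRow A
  oc = openCol A
  cr = closeRow A
  cc = closeCol A
  f0 = ent A
  f1 : ℕ → ℕ → ℤ
  f1 r j = if (r ≡ᵇ cr) ∧ ((j ≡ᵇ oc) ∨ (j ≡ᵇ cc)) then 0ℤ else f0 r j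
  -- (2) H on the extended closing cell: rows cr+1..n, columns oc..cc
  in2 : ℕ → ℕ → Bool
  in2 r j = (cr <ᵇ r) ∧ (r ≤ᵇ n) ∧ (oc ≤ᵇ j) ∧ (j ≤ᵇ cc)
  colNZ : ℕ → Bool
  colNZ q = any (λ r → not (f1 r q == 0ℤ)) (rng (suc cr) n)
  prevNZ : ℕ → ℕ
  prevNZ q = lastℕ colNZ (rng oc (q ∸ 1))
  f2 : ℕ → ℕ → ℤ
  f2 r j = if in2 r j
           then (if (j ≡ᵇ cc) ∨ ((oc <ᵇ j) ∧ colNZ j) then f1 r (prevNZ j) else 0ℤ)
           else f1 r j
  -- (3) V on the extended neutral cell: rows or..cr, columns 1..oc-1
  in3 : ℕ → ℕ → Bool
  in3 r j = (or ≤ᵇ r) ∧ (r ≤ᵇ cr) ∧ (1 ≤ᵇ j) ∧ (j <ᵇ oc)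
  rowNZ : ℕ → Bool
  rowNZ q = any (λ j → not (f2 q j == 0ℤ)) (rng 1 (oc ∸ 1))
  nextNZ : ℕ → ℕ
  nextNZ q = firstℕ rowNZ (rng (suc q) cr)
  f3 : ℕ → ℕ → ℤ
  f3 r j = if in3 r j
           then (if (r ≡ᵇ or) ∨ (rowNZ r ∧ (r <ᵇ cr)) then f2 (nextNZ r) j else 0ℤ)
           else f2 r j
  -- (4) move every 1 of the extended neutral cell and of the charged cell
  --     (rows or+1..cr-1, columns oc+1..n) down one row
  inR : ℕ → ℕ → Bool
  inR r j = in3 r j ∨ ((or <ᵇ r) ∧ (r <ᵇ cr) ∧ (oc <ᵇ j) ∧ (j ≤ᵇ n))
  f4 : ℕ → ℕ → ℤ
  f4 r j = if (1 ≤ᵇ r) ∧ inR (r ∸ 1) j ∧ (f3 (r ∸ 1) j == 1ℤ) then 1ℤ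
           else (if inR r j then 0ℤ else f3 r j)

Δ : ∀ {n} → Mat n → ℕ × Mat n × ℤ × ℤ
Δ A = openRow A , δ A , cval A , Eval A

-- The map Λ, as a relation:  Lam A N E  means  Λ(A) = (N , E).

LamNN : ∀ {n} → Mat n → Mat n → ℤ → Set
LamNN A N E =
  InA N × sign N ≡ neu
  × Δ N ≡ (openRow A , δ A , cval A + Eval A , 0ℤ)
  × E ≡ Eval A

lamBy : ∀ {n} → Sign → Mat n → Mat n → ℤ → Set
lamBy neg A N E = LamNN (reflect A) (reflect N) (- E)
lamBy pos A N E = LamNN A N E
lamBy neu A N E = LamNN A N E

Lam : ∀ {n} → Mat n → Mat n → ℤ → Set
Lam A N E = lamBy (sign A) A N E

record GIT (n : ℕ) : Set where
  constructor git
  field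
    k : ℕ
    a : Vec ℤ n
    b : ℤ
    β : ℤ

aEntry : ∀ {n} → Mat n → ℕ → ℤ
aEntry {n} N i = boxSum N (suc r) n 1 (oneCol N r ∸ 1)
  where r = suc n ∸ i

genTable : ∀ {n} → Mat n → ℤ → GIT n
genTable {n} N E = git (suc n ∸ openRow N)
                       (tabulate (λ i → aEntry N (suc (toℕ i))))
                       (cval N)
                       (E + ℓval N)

-- a_i read from the vector, 1-based
aAt : ∀ {n} → Vec ℤ n → ℕ → ℤ
aAt a zero = 0ℤ
aAt a (suc i) = vget 0ℤ a i

{-# OPTIONS --safe #-}
module Submission where

-- Λ(A) = (N , E) and Λ(A′) = (N , c(N) - ℓ(N) - E) share N, and β = E + ℓ(N); so the claim is
-- the identity a_k = a_{k-1} + 1 + ℓ(N) for the neutral matrix N. In N the closing row lies directly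
-- below the opening row, whose only nonzero entry is the 1 in the opening column; the closing row
-- holds the leading 1, the -1 and one 1 on the right, and the column of the leading 1 vanishes
-- below it. So the region counted by a_k (below the opening row, left of the opening column)
-- consists of the leading 1, the region counted by a_{k-1} (below the closing row, left of the
-- leading column) and the region counted by ℓ(N). If A is negative, N is the reflection of a
-- neutral matrix, which has the same shape with the two 1s of the closing row exchanged.

open import Defs
open import Data.Bool using (Bool; true; false; T; if_then_else_)
open import Data.Bool.Properties using (∨-zeroʳ)
open import Data.Bool.ListAction using (any)
open import Data.Empty using (⊥-elim)
open import Data.Fin as Fin using (Fin; toℕ; fromℕ<)
open import Data.Fin.Properties using (toℕ-fromℕ<)
open import Data.Integer using (ℤ; 0ℤ; 1ℤ; -1ℤ; +_; -[1+_]; _+_; _-_; _≟_)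
import Data.Integer.Properties as ℤ
open import Algebra.Properties.CommutativeSemigroup ℤ.+-commutativeSemigroup using (interchange)
open import Data.Integer.Solver using (module +-*-Solver)
open import Data.List using (List; []; _∷_; _++_; map; concatMap; filter; length; applyUpTo)
open import Data.List.Properties using (map-++; map-cong; length-++; filter-++)
open import Data.List.Membership.Propositional using (_∈_)
open import Data.List.Membership.Propositional.Properties using (∈-applyUpTo⁻; ∈-applyUpTo⁺)
open import Data.List.Relation.Unary.Any using (here; there)
open import Data.List.Relation.Unary.All as All using ()
open import Data.List.Relation.Unary.AllPairs using (AllPairs; _∷_)
open import Data.List.Relation.Unary.AllPairs.Properties using (applyUpTo⁺₁)
open import Data.Nat using (ℕ; zero; suc; _∸_; _≤_; _<_; z≤n; s≤s) renaming (_+_ to _+ℕ_)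
import Data.Nat.Properties as ℕ
open import Data.Product using (∃; ∃₂; _×_; _,_; proj₁; proj₂)
open import Data.Vec as Vec using (Vec; toList; replicate; lookup; tabulate)
open import Function using (_∘_)
open import Relation.Nullary using (¬_; yes; no)
open import Relation.Nullary.Decidable using (dec-true; dec-false; isYes≗does)
open import Relation.Binary.PropositionalEquality

0≢1 : 0ℤ ≢ 1ℤ
0≢1 ()

infixl 9 _!_
_!_ : List ℤ → ℕ → ℤ
[]       ! _     = 0ℤ
(x ∷ _)  ! zero  = x
(_ ∷ xs) ! suc i = xs ! i

Alt-head : ∀ {x xs} → Alt (x ∷ xs) → x ≡ 1ℤ
Alt-head alt-one      = refl
Alt-head (alt-more _) = refl

nonzeros≡[]⇒zero : ∀ xs → nonzeros xs ≡ [] → ∀ j → xs ! j ≡ 0ℤ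
nonzeros≡[]⇒zero []             _  _       = refl
nonzeros≡[]⇒zero (+ zero ∷ xs)  _  zero    = refl
nonzeros≡[]⇒zero (+ zero ∷ xs)  eq (suc j) = nonzeros≡[]⇒zero xs eq j
nonzeros≡[]⇒zero (+ suc _ ∷ _)  ()
nonzeros≡[]⇒zero (-[1+ _ ] ∷ _) ()

nonzeros≡∷⇒! : ∀ xs {y ys} → nonzeros xs ≡ y ∷ ys → ∃ λ j → xs ! j ≡ y
nonzeros≡∷⇒! []             ()
nonzeros≡∷⇒! (+ zero ∷ xs)  eq with nonzeros≡∷⇒! xs eq
... | j , xs!j = suc j , xs!j
nonzeros≡∷⇒! (+ suc _ ∷ _)  refl = zero , refl
nonzeros≡∷⇒! (-[1+ _ ] ∷ _) refl = zero , refl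

Alt-no-minus⇒single-one : ∀ xs → Alt (nonzeros xs) → (∀ j → xs ! j ≢ -1ℤ) →
  ∃ λ l → xs ! l ≡ 1ℤ × (∀ j → j ≢ l → xs ! j ≡ 0ℤ)
Alt-no-minus⇒single-one []             () _
Alt-no-minus⇒single-one (+ zero ∷ xs)  alt no-minus
  with Alt-no-minus⇒single-one xs alt (no-minus ∘ suc)
... | l , one , zeros = suc l , one , λ where
  zero    _   → refl
  (suc j) j≢l → zeros j (j≢l ∘ cong suc)
Alt-no-minus⇒single-one (+ suc _ ∷ xs) alt no-minus with Alt-head alt | nonzeros xs in eq | alt
... | refl | []    | _          = zero , refl , λ where
  zero    0≢0 → ⊥-elim (0≢0 refl)
  (suc j) _   → nonzeros≡[]⇒zero xs eq j
... | refl | _ ∷ _ | alt-more _ with nonzeros≡∷⇒! xs eq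
...   | j , xs!j = ⊥-elim (no-minus (suc j) xs!j)
Alt-no-minus⇒single-one (-[1+ _ ] ∷ _) alt _ with Alt-head alt
... | ()

record Flanked (f : ℕ → ℤ) (p : ℕ) : Set where
  field
    before after   : ℕ
    before<p       : before < p
    p<after        : p < after
    before-one     : f before ≡ 1ℤ
    after-one      : f after ≡ 1ℤ
    elsewhere-zero : ∀ j → j ≢ before → j ≢ p → j ≢ after → f j ≡ 0ℤ

Flanked-cong : ∀ {f g p} → (∀ j → f j ≡ g j) → Flanked f p → Flanked g p
Flanked-cong f≗g F = record
  { before<p       = before<p
  ; p<after        = p<after
  ; before-one     = trans (sym (f≗g _)) before-one
  ; after-one      = trans (sym (f≗g _)) after-one
  ; elsewhere-zero = λ j j≢b j≢p j≢a → trans (sym (f≗g j)) (elsewhere-zero j j≢b j≢p j≢a)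
  }
  where open Flanked F

Flanked-0∷ : ∀ {xs p} → Flanked (xs !_) p → Flanked ((+ 0 ∷ xs) !_) (suc p)
Flanked-0∷ F = record
  { before<p       = s≤s before<p
  ; p<after        = s≤s p<after
  ; before-one     = before-one
  ; after-one      = after-one
  ; elsewhere-zero = λ where
      zero    _   _   _   → refl
      (suc j) j≢b j≢p j≢a → elsewhere-zero j (j≢b ∘ cong suc) (j≢p ∘ cong suc) (j≢a ∘ cong suc)
  }
  where open Flanked F

Alt-minus-first⇒one-after : ∀ xs {ys} → nonzeros xs ≡ -1ℤ ∷ ys → Alt ys →
  ∀ p → xs ! p ≡ -1ℤ → (∀ q → xs ! q ≡ -1ℤ → q ≡ p) →
  ∃ λ r → p < r × xs ! r ≡ 1ℤ × (∀ j → j ≢ p → j ≢ r → xs ! j ≡ 0ℤ)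
Alt-minus-first⇒one-after []                ()
Alt-minus-first⇒one-after (+ zero ∷ xs)     eq alt zero ()
Alt-minus-first⇒one-after (+ zero ∷ xs)     eq alt (suc p) minus unique
  with Alt-minus-first⇒one-after xs eq alt p minus (λ q → ℕ.suc-injective ∘ unique (suc q))
... | r , p<r , one , zeros = suc r , s≤s p<r , one , λ where
  zero    _   _   → refl
  (suc j) j≢p j≢r → zeros j (j≢p ∘ cong suc) (j≢r ∘ cong suc)
Alt-minus-first⇒one-after (+ suc _ ∷ _)     ()
Alt-minus-first⇒one-after (-[1+ suc _ ] ∷ _) ()
Alt-minus-first⇒one-after (-[1+ zero ] ∷ xs) refl alt p minus unique with unique zero refl
... | refl with Alt-no-minus⇒single-one xs alt (λ q → ℕ.1+n≢0 ∘ unique (suc q))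
...   | l , one , zeros = suc l , s≤s z≤n , one , λ where
  zero    0≢0 _   → ⊥-elim (0≢0 refl)
  (suc j) _   j≢l → zeros j (j≢l ∘ cong suc)

Alt-single-minus⇒flanked : ∀ xs → Alt (nonzeros xs) →
  ∀ p → xs ! p ≡ -1ℤ → (∀ q → xs ! q ≡ -1ℤ → q ≡ p) → Flanked (xs !_) p
Alt-single-minus⇒flanked []                 ()
Alt-single-minus⇒flanked (+ zero ∷ xs)      alt zero    ()
Alt-single-minus⇒flanked (+ zero ∷ xs)      alt (suc p) minus unique =
  Flanked-0∷ (Alt-single-minus⇒flanked xs alt p minus (λ q → ℕ.suc-injective ∘ unique (suc q)))
Alt-single-minus⇒flanked (+ suc _ ∷ xs)     alt zero    ()
Alt-single-minus⇒flanked (+ suc _ ∷ xs)     alt (suc p) minus unique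
  with Alt-head alt | nonzeros xs in eq | alt
... | refl | []    | _ with trans (sym (nonzeros≡[]⇒zero xs eq p)) minus
...   | ()
Alt-single-minus⇒flanked (+ suc _ ∷ xs)     alt (suc p) minus unique
    | refl | _ ∷ _ | alt-more alt′
  with Alt-minus-first⇒one-after xs eq alt′ p minus (λ q → ℕ.suc-injective ∘ unique (suc q))
... | r , p<r , one , zeros = record
  { before<p       = s≤s z≤n
  ; p<after        = s≤s p<r
  ; before-one     = refl
  ; after-one      = one
  ; elsewhere-zero = λ where
      zero    0≢0 _   _   → ⊥-elim (0≢0 refl)
      (suc j) _   j≢p j≢r → zeros j (j≢p ∘ cong suc) (j≢r ∘ cong suc)
  }
Alt-single-minus⇒flanked (-[1+ _ ] ∷ _)     alt _ _ _ with Alt-head alt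
... | ()

record AltLine (f : ℕ → ℤ) : Set where
  field
    list   : List ℤ
    alt    : Alt (nonzeros list)
    list-! : ∀ i → list ! i ≡ f i

module _ {f : ℕ → ℤ} (L : AltLine f) where
  open AltLine L

  AltLine-no-minus⇒zero : (∀ j → f j ≢ -1ℤ) → ∀ {i} → f i ≡ 1ℤ → ∀ j → j ≢ i → f j ≡ 0ℤ
  AltLine-no-minus⇒zero no-minus {i} one j j≢i
    with Alt-no-minus⇒single-one list alt (λ q → no-minus q ∘ trans (sym (list-! q)))
  ... | l , one-l , zeros with i ℕ.≟ l
  ...   | yes refl = trans (sym (list-! j)) (zeros j j≢i)
  ...   | no  i≢l  = ⊥-elim (0≢1 (trans (sym (trans (sym (list-! i)) (zeros i i≢l))) one))

  AltLine-single-minus⇒flanked : ∀ {p} → f p ≡ -1ℤ → (∀ q → f q ≡ -1ℤ → q ≡ p) → Flanked f p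
  AltLine-single-minus⇒flanked {p} minus unique = Flanked-cong list-!
    (Alt-single-minus⇒flanked list alt p (trans (list-! p) minus) (λ q → unique q ∘ trans (sym (list-! q))))

minusCount : List ℤ → ℕ
minusCount xs = length (filter (_≟ -1ℤ) xs)

minusCount-++ : ∀ xs ys → minusCount (xs ++ ys) ≡ minusCount xs +ℕ minusCount ys
minusCount-++ xs ys = trans (cong length (filter-++ (_≟ -1ℤ) xs ys)) (length-++ (filter (_≟ -1ℤ) xs))

minusCount-∷ : ∀ x xs → minusCount xs ≤ minusCount (x ∷ xs)
minusCount-∷ (+ _)            xs = ℕ.≤-refl
minusCount-∷ -[1+ zero ]      xs = ℕ.n≤1+n _
minusCount-∷ -[1+ suc _ ]     xs = ℕ.≤-refl

minus⇒1≤minusCount : ∀ xs i → xs ! i ≡ -1ℤ → 1 ≤ minusCount xs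
minus⇒1≤minusCount []       i       ()
minus⇒1≤minusCount (x ∷ xs) zero    refl  = s≤s z≤n
minus⇒1≤minusCount (x ∷ xs) (suc i) minus = ℕ.≤-trans (minus⇒1≤minusCount xs i minus) (minusCount-∷ x xs)

two-minus⇒2≤minusCount : ∀ xs i j → i ≢ j → xs ! i ≡ -1ℤ → xs ! j ≡ -1ℤ → 2 ≤ minusCount xs
two-minus⇒2≤minusCount []       i       j       _   ()
two-minus⇒2≤minusCount (x ∷ xs) zero    zero    0≢0 _    _  = ⊥-elim (0≢0 refl)
two-minus⇒2≤minusCount (x ∷ xs) zero    (suc j) _   refl mj = s≤s (minus⇒1≤minusCount xs j mj)
two-minus⇒2≤minusCount (x ∷ xs) (suc i) zero    _   mi refl = s≤s (minus⇒1≤minusCount xs i mi)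
two-minus⇒2≤minusCount (x ∷ xs) (suc i) (suc j) i≢j mi mj =
  ℕ.≤-trans (two-minus⇒2≤minusCount xs i j (i≢j ∘ cong suc) mi mj) (minusCount-∷ x xs)

2≰1 : ¬ 2 ≤ 1
2≰1 (s≤s ())

minusCount≤1⇒unique : ∀ xs {i j} → minusCount xs ≤ 1 → xs ! i ≡ -1ℤ → xs ! j ≡ -1ℤ → i ≡ j
minusCount≤1⇒unique xs {i} {j} ≤1 mi mj with i ℕ.≟ j
... | yes i≡j = i≡j
... | no  i≢j = ⊥-elim (2≰1 (ℕ.≤-trans (two-minus⇒2≤minusCount xs i j i≢j mi mj) ≤1))

1≤minusCount⇒minus : ∀ xs → 1 ≤ minusCount xs → ∃ λ i → xs ! i ≡ -1ℤ
1≤minusCount⇒minus []                 ()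
1≤minusCount⇒minus (-[1+ zero ] ∷ xs)  _  = zero , refl
1≤minusCount⇒minus (+ _ ∷ xs)         1≤ with 1≤minusCount⇒minus xs 1≤
... | i , minus = suc i , minus
1≤minusCount⇒minus (-[1+ suc _ ] ∷ xs) 1≤ with 1≤minusCount⇒minus xs 1≤
... | i , minus = suc i , minus

-- Matrices, read with 0-based indices: ent M (suc i) (suc j) reduces to entry₀ M i j.
-- As in ent, positions outside the matrix read as 0.

entry₀ : ∀ {m n} → Vec (Vec ℤ n) m → ℕ → ℕ → ℤ
entry₀ {n = n} M i j = vget 0ℤ (vget (replicate n 0ℤ) M i) j

entries : ∀ {m n} → Vec (Vec ℤ n) m → List ℤ
entries M = concatMap toList (toList M)

vget-toList : ∀ {n} (v : Vec ℤ n) j → vget 0ℤ v j ≡ toList v ! j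
vget-toList Vec.[]       j       = refl
vget-toList (x Vec.∷ v) zero    = refl
vget-toList (x Vec.∷ v) (suc j) = vget-toList v j

vget-replicate : ∀ {A : Set} (d : A) n j → vget d (replicate n d) j ≡ d
vget-replicate d zero    j       = refl
vget-replicate d (suc n) zero    = refl
vget-replicate d (suc n) (suc j) = vget-replicate d n j

vget-≥ : ∀ {A : Set} {n} (d : A) (v : Vec A n) j → n ≤ j → vget d v j ≡ d
vget-≥ d Vec.[]       j       _         = refl
vget-≥ d (x Vec.∷ v) (suc j) (s≤s n≤j) = vget-≥ d v j n≤j

vget-lookup : ∀ {A : Set} {n} (d : A) (v : Vec A n) (J : Fin n) → vget d v (toℕ J) ≡ lookup v J
vget-lookup d (x Vec.∷ v) Fin.zero    = refl
vget-lookup d (x Vec.∷ v) (Fin.suc J) = vget-lookup d v J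

vget-tabulate : ∀ {A : Set} {n} (d : A) (g : Fin n → A) i (i<n : i < n) →
  vget d (tabulate g) i ≡ g (fromℕ< i<n)
vget-tabulate {n = suc n} d g zero    _         = refl
vget-tabulate {n = suc n} d g (suc i) (s≤s i<n) = vget-tabulate d (g ∘ Fin.suc) i i<n

minus⇒1≤countMinus : ∀ {m n} (M : Vec (Vec ℤ n) m) i j → entry₀ M i j ≡ -1ℤ → 1 ≤ minusCount (entries M)
minus⇒1≤countMinus {n = n} Vec.[] i j minus with trans (sym (vget-replicate 0ℤ n j)) minus
... | ()
minus⇒1≤countMinus (v Vec.∷ M) zero j minus rewrite minusCount-++ (toList v) (entries M) =
  ℕ.≤-trans (minus⇒1≤minusCount (toList v) j (trans (sym (vget-toList v j)) minus)) (ℕ.m≤m+n _ _)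
minus⇒1≤countMinus (v Vec.∷ M) (suc i) j minus rewrite minusCount-++ (toList v) (entries M) =
  ℕ.≤-trans (minus⇒1≤countMinus M i j minus) (ℕ.m≤n+m _ _)

countMinus≤1⇒unique : ∀ {m n} (M : Vec (Vec ℤ n) m) {i j i′ j′} → minusCount (entries M) ≤ 1 →
  entry₀ M i j ≡ -1ℤ → entry₀ M i′ j′ ≡ -1ℤ → i ≡ i′ × j ≡ j′
countMinus≤1⇒unique {n = n} Vec.[] {j = j} _ minus _ with trans (sym (vget-replicate 0ℤ n j)) minus
... | ()
countMinus≤1⇒unique (v Vec.∷ M) {zero} {j} {zero} {j′} ≤1 mi mj rewrite minusCount-++ (toList v) (entries M) =
  refl , minusCount≤1⇒unique (toList v) (ℕ.m+n≤o⇒m≤o _ ≤1)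
           (trans (sym (vget-toList v j)) mi) (trans (sym (vget-toList v j′)) mj)
countMinus≤1⇒unique (v Vec.∷ M) {zero} {j} {suc i′} ≤1 mi mj rewrite minusCount-++ (toList v) (entries M) =
  ⊥-elim (2≰1 (ℕ.≤-trans (ℕ.+-mono-≤ (minus⇒1≤minusCount (toList v) j (trans (sym (vget-toList v j)) mi))
                                        (minus⇒1≤countMinus M i′ _ mj)) ≤1))
countMinus≤1⇒unique (v Vec.∷ M) {suc i} {j} {zero} {j′} ≤1 mi mj rewrite minusCount-++ (toList v) (entries M) =
  ⊥-elim (2≰1 (ℕ.≤-trans (ℕ.+-mono-≤ (minus⇒1≤minusCount (toList v) j′ (trans (sym (vget-toList v j′)) mj))
                                        (minus⇒1≤countMinus M i _ mi)) ≤1))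
countMinus≤1⇒unique (v Vec.∷ M) {suc i} {j} {suc i′} ≤1 mi mj rewrite minusCount-++ (toList v) (entries M)
  with countMinus≤1⇒unique M (ℕ.m+n≤o⇒n≤o _ ≤1) mi mj
... | i≡i′ , j≡j′ = cong suc i≡i′ , j≡j′

1≤countMinus⇒minus : ∀ {m n} (M : Vec (Vec ℤ n) m) → 1 ≤ minusCount (entries M) →
  ∃₂ λ i j → entry₀ M i j ≡ -1ℤ
1≤countMinus⇒minus Vec.[] ()
1≤countMinus⇒minus (v Vec.∷ M) 1≤ rewrite minusCount-++ (toList v) (entries M) with minusCount (toList v) in eq
... | zero with 1≤countMinus⇒minus M 1≤
...   | i , j , minus = suc i , j , minus
1≤countMinus⇒minus (v Vec.∷ M) 1≤ | suc _ with 1≤minusCount⇒minus (toList v) (subst (1 ≤_) (sym eq) (s≤s z≤n))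
...   | j , minus = zero , j , trans (vget-toList v j) minus

record UniqueMinusAt {n} (M : Mat n) (i j : ℕ) : Set where
  field
    minus-entry  : entry₀ M i j ≡ -1ℤ
    minus-unique : ∀ i′ j′ → entry₀ M i′ j′ ≡ -1ℤ → i′ ≡ i × j′ ≡ j

InA⇒UniqueMinusAt : ∀ {n} {M : Mat n} → InA M → ∃₂ λ i j → UniqueMinusAt M i j
InA⇒UniqueMinusAt {M = M} (_ , one-minus) with 1≤countMinus⇒minus M (ℕ.≤-reflexive (sym one-minus))
... | i , j , minus = i , j , record
  { minus-entry  = minus
  ; minus-unique = λ i′ j′ m′ → countMinus≤1⇒unique M (ℕ.≤-reflexive one-minus) m′ minus
  }

module _ {m n} (M : Vec (Vec ℤ n) m) where

  entry₀-row≥ : ∀ i j → m ≤ i → entry₀ M i j ≡ 0ℤ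
  entry₀-row≥ i j m≤i rewrite vget-≥ (replicate n 0ℤ) M i m≤i = vget-replicate 0ℤ n j

  entry₀-col≥ : ∀ i j → n ≤ j → entry₀ M i j ≡ 0ℤ
  entry₀-col≥ i j = vget-≥ 0ℤ (vget (replicate n 0ℤ) M i) j

  nonzero⇒row< : ∀ {i j x} → entry₀ M i j ≡ x → x ≢ 0ℤ → i < m
  nonzero⇒row< {i} {j} e x≢0 with i ℕ.<? m
  ... | yes i<m = i<m
  ... | no  i≮m = ⊥-elim (x≢0 (trans (sym e) (entry₀-row≥ i j (ℕ.≮⇒≥ i≮m))))

  nonzero⇒col< : ∀ {i j x} → entry₀ M i j ≡ x → x ≢ 0ℤ → j < n
  nonzero⇒col< {i} {j} e x≢0 with j ℕ.<? n
  ... | yes j<n = j<n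
  ... | no  j≮n = ⊥-elim (x≢0 (trans (sym e) (entry₀-col≥ i j (ℕ.≮⇒≥ j≮n))))

vget-column : ∀ {m n} (M : Vec (Vec ℤ n) m) (J : Fin n) i →
  vget 0ℤ (Vec.map (λ row → lookup row J) M) i ≡ entry₀ M i (toℕ J)
vget-column {n = n} Vec.[]       J i       = sym (vget-replicate 0ℤ n (toℕ J))
vget-column         (v Vec.∷ M) J zero    = sym (vget-lookup 0ℤ v J)
vget-column         (v Vec.∷ M) J (suc i) = vget-column M J i

module _ {n} (M : Mat n) (asm : IsASM M) where

  rowLine : ∀ {i} → i < n → AltLine (entry₀ M i)
  rowLine {i} i<n = record
    { list   = toList (lookup M ι)
    ; alt    = proj₁ (proj₂ asm) ι
    ; list-! = λ j → trans (sym (vget-toList (lookup M ι) j)) (cong (λ v → vget 0ℤ v j) (sym row-ι))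
    }
    where
    ι = fromℕ< i<n
    row-ι : vget (replicate n 0ℤ) M i ≡ lookup M ι
    row-ι = trans (cong (vget _ M) (sym (toℕ-fromℕ< i<n))) (vget-lookup _ M ι)

  colLine : ∀ {j} → j < n → AltLine (λ i → entry₀ M i j)
  colLine {j} j<n = record
    { list   = toList column
    ; alt    = proj₂ (proj₂ asm) κ
    ; list-! = λ i → trans (sym (vget-toList column i))
                           (trans (vget-column M κ i) (cong (entry₀ M i) (toℕ-fromℕ< j<n)))
    }
    where
    κ = fromℕ< j<n
    column = Vec.map (λ row → lookup row κ) M

==-true : ∀ {x y} → x ≡ y → (x == y) ≡ true
==-true {x} {y} x≡y = trans (isYes≗does (x ≟ y)) (dec-true (x ≟ y) x≡y)

==-false : ∀ {x y} → x ≢ y → (x == y) ≡ false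
==-false {x} {y} x≢y = trans (isYes≗does (x ≟ y)) (dec-false (x ≟ y) x≢y)

any-true : ∀ (p : ℕ → Bool) {x xs} → x ∈ xs → p x ≡ true → any p xs ≡ true
any-true p (here refl) px rewrite px = refl
any-true p {xs = y ∷ _} (there x∈xs) px rewrite any-true p x∈xs px = ∨-zeroʳ (p y)

any-false : ∀ (p : ℕ → Bool) xs → (∀ x → x ∈ xs → p x ≡ false) → any p xs ≡ false
any-false p []       _     = refl
any-false p (x ∷ xs) none rewrite none x (here refl) = any-false p xs (λ y → none y ∘ there)

applyUpTo-cong : ∀ {A : Set} {f g : ℕ → A} → (∀ i → f i ≡ g i) → ∀ k → applyUpTo f k ≡ applyUpTo g k
applyUpTo-cong f≗g zero    = refl
applyUpTo-cong f≗g (suc k) = cong₂ _∷_ (f≗g zero) (applyUpTo-cong (f≗g ∘ suc) k)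

rng-∷ : ∀ {lo hi} → lo ≤ hi → rng lo hi ≡ lo ∷ rng (suc lo) hi
rng-∷ {lo} {hi} lo≤hi rewrite ℕ.+-∸-assoc 1 lo≤hi =
  cong₂ _∷_ (ℕ.+-identityʳ lo) (applyUpTo-cong (ℕ.+-suc lo) (hi ∸ lo))

rng-++ : ∀ {lo m hi} → lo ≤ suc m → m ≤ hi → rng lo hi ≡ rng lo m ++ rng (suc m) hi
rng-++ {lo} {m} {hi} lo≤1+m m≤hi = split (suc m ∸ lo) lo (ℕ.m∸n+n≡m lo≤1+m)
  where
  split : ∀ k lo → k +ℕ lo ≡ suc m → rng lo hi ≡ rng lo m ++ rng (suc m) hi
  split zero    lo refl rewrite ℕ.n∸n≡0 m = refl
  split (suc k) lo eq = begin
      rng lo hi                           ≡⟨ rng-∷ (ℕ.≤-trans lo≤m m≤hi) ⟩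
      lo ∷ rng (suc lo) hi                ≡⟨ cong (lo ∷_) (split k (suc lo) (trans (ℕ.+-suc k lo) eq)) ⟩
      lo ∷ rng (suc lo) m ++ rng (suc m) hi ≡⟨ cong (_++ rng (suc m) hi) (rng-∷ lo≤m) ⟨
      rng lo m ++ rng (suc m) hi          ∎
    where
    open ≡-Reasoning
    lo≤m : lo ≤ m
    lo≤m = ℕ.m+n≤o⇒n≤o k (ℕ.≤-reflexive (ℕ.suc-injective eq))

<∸⇒+< : ∀ i a b → i < a ∸ b → b +ℕ i < a
<∸⇒+< i (suc a) zero    i<a = i<a
<∸⇒+< i (suc a) (suc b) i<  = s≤s (<∸⇒+< i a b i<)

∈-rng⁻ : ∀ {x lo hi} → x ∈ rng lo hi → lo ≤ x × x ≤ hi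
∈-rng⁻ {lo = lo} {hi} x∈ with ∈-applyUpTo⁻ (lo +ℕ_) x∈
... | i , i< , refl = ℕ.m≤m+n lo i , ℕ.≤-pred (<∸⇒+< i (suc hi) lo i<)

∈-rng⁺ : ∀ {x lo hi} → lo ≤ x → x ≤ hi → x ∈ rng lo hi
∈-rng⁺ {x} {lo} {hi} lo≤x x≤hi =
  subst (_∈ rng lo hi) (ℕ.m+[n∸m]≡n lo≤x) (∈-applyUpTo⁺ (lo +ℕ_) (ℕ.∸-monoˡ-< (s≤s x≤hi) lo≤x))

rng-sorted : ∀ lo hi → AllPairs _<_ (rng lo hi)
rng-sorted lo hi = applyUpTo⁺₁ (lo +ℕ_) (suc hi ∸ lo) (λ i<j _ → ℕ.+-monoʳ-< lo i<j)

firstℕ-least : ∀ (p : ℕ → Bool) {xs x} → AllPairs _<_ xs → x ∈ xs → p x ≡ true →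
  (∀ z → z ∈ xs → z < x → p z ≡ false) → firstℕ p xs ≡ x
firstℕ-least p _ (here refl) px _ rewrite px = refl
firstℕ-least p {y ∷ _} (y< ∷ sorted) (there x∈) px earlier rewrite earlier y (here refl) (All.lookup y< x∈) =
  firstℕ-least p sorted x∈ px (λ z → earlier z ∘ there)

firstℕ-rng : ∀ (p : ℕ → Bool) {lo hi x} → lo ≤ x → x ≤ hi → p x ≡ true →
  (∀ z → lo ≤ z → z < x → p z ≡ false) → firstℕ p (rng lo hi) ≡ x
firstℕ-rng p {lo} {hi} lo≤x x≤hi px earlier =
  firstℕ-least p (rng-sorted lo hi) (∈-rng⁺ lo≤x x≤hi) px (λ z → earlier z ∘ proj₁ ∘ ∈-rng⁻)

firstℕ-from1 : ∀ (p : ℕ → Bool) {hi x} → x < hi → p (suc x) ≡ true →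
  (∀ z → z < x → p (suc z) ≡ false) → firstℕ p (rng 1 hi) ≡ suc x
firstℕ-from1 p x<hi px earlier = firstℕ-rng p (s≤s z≤n) x<hi px λ where
  (suc z) _ (s≤s z<x) → earlier z z<x

module _ {n} {M : Mat n} {i c} (U : UniqueMinusAt M i c) where
  open UniqueMinusAt U

  closeRow≡ : closeRow M ≡ suc i
  closeRow≡ = firstℕ-from1 _ (nonzero⇒row< M minus-entry (λ ()))
    (any-true _ (∈-rng⁺ (s≤s z≤n) (nonzero⇒col< M minus-entry (λ ()))) (==-true minus-entry))
    (λ z z<i → any-false _ (rng 1 n) λ where
      zero    _ → refl
      (suc j) _ → ==-false (ℕ.<⇒≢ z<i ∘ proj₁ ∘ minus-unique z j))

  openCol≡ : openCol M ≡ suc c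
  openCol≡ = trans (cong (λ r → firstℕ (λ j → ent M r j == -1ℤ) (rng 1 n)) closeRow≡)
    (firstℕ-from1 _ (nonzero⇒col< M minus-entry (λ ())) (==-true minus-entry)
      (λ z z<c → ==-false (ℕ.<⇒≢ z<c ∘ proj₂ ∘ minus-unique i z)))

  openRow≡ : ∀ {o} → entry₀ M o c ≡ 1ℤ → (∀ i′ → i′ < o → entry₀ M i′ c ≡ 0ℤ) → openRow M ≡ suc o
  openRow≡ one above = trans (cong (λ j → firstℕ (λ r → ent M r j == 1ℤ) (rng 1 n)) openCol≡)
    (firstℕ-from1 _ (nonzero⇒row< M one (λ ())) (==-true one)
      (λ z z<o → ==-false (0≢1 ∘ trans (sym (above z z<o)))))

firstOneInRow : ∀ {n} {M : Mat n} {i x hi} → x < hi → entry₀ M i x ≡ 1ℤ →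
  (∀ j → j < x → entry₀ M i j ≡ 0ℤ) → firstℕ (λ j → ent M (suc i) j == 1ℤ) (rng 1 hi) ≡ suc x
firstOneInRow x<hi one before =
  firstℕ-from1 _ x<hi (==-true one) (λ z z<x → ==-false (0≢1 ∘ trans (sym (before z z<x))))

neutral⇒adjacent : ∀ {n} {M : Mat n} → sign M ≡ neu → closeRow M ≤ suc (openRow M)
neutral⇒adjacent neutral = ℕ.≤ᵇ⇒≤ _ _ (if-neu _ _ neutral)
  where
  if-neu : ∀ b b′ → (if b then neu else (if b′ then pos else neg)) ≡ neu → T b
  if-neu true  _     _  = _
  if-neu false true  ()
  if-neu false false ()

-- 0-based positions: the opening row is o, the closing row suc o, the opening column c;
-- the closing row has its 1s in columns l < c < r.
record NeutralShape {n} (M : Mat n) : Set where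
  field
    o c l r       : ℕ
    l<c           : l < c
    c<r           : c < r
    minus         : UniqueMinusAt M (suc o) c
    opening-one   : entry₀ M o c ≡ 1ℤ
    above-opening : ∀ i → i < o → entry₀ M i c ≡ 0ℤ
    opening-row   : ∀ j → j ≢ c → entry₀ M o j ≡ 0ℤ
    left-one      : entry₀ M (suc o) l ≡ 1ℤ
    right-one     : entry₀ M (suc o) r ≡ 1ℤ
    closing-row   : ∀ j → j ≢ l → j ≢ c → j ≢ r → entry₀ M (suc o) j ≡ 0ℤ
    left-column   : ∀ i → i ≢ suc o → entry₀ M i l ≡ 0ℤ
    right-column  : ∀ i → i ≢ suc o → entry₀ M i r ≡ 0ℤ

minus-below-first-one⇒shape : ∀ {n} {M : Mat n} → IsASM M → ∀ {o c} → UniqueMinusAt M (suc o) c →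
  entry₀ M o c ≡ 1ℤ → (∀ i → i < o → entry₀ M i c ≡ 0ℤ) → NeutralShape M
minus-below-first-one⇒shape {n} {M} asm {o} {c} U opening-one above = record
  { l<c           = before<p
  ; c<r           = p<after
  ; minus         = U
  ; opening-one   = opening-one
  ; above-opening = above
  ; opening-row   = AltLine-no-minus⇒zero (rowLine M asm (ℕ.<-trans (ℕ.n<1+n o) closing<n))
                      (λ j → ℕ.1+n≢n ∘ sym ∘ proj₁ ∘ minus-unique o j) opening-one
  ; left-one      = before-one
  ; right-one     = after-one
  ; closing-row   = elsewhere-zero
  ; left-column   = column-zero (ℕ.<⇒≢ before<p) before-one
  ; right-column  = column-zero (ℕ.>⇒≢ p<after) after-one
  }
  where
  open UniqueMinusAt U
  closing<n : suc o < n
  closing<n = nonzero⇒row< M minus-entry (λ ())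
  open Flanked (AltLine-single-minus⇒flanked (rowLine M asm closing<n) minus-entry
                  (λ j → proj₂ ∘ minus-unique (suc o) j))
  column-zero : ∀ {j} → j ≢ c → entry₀ M (suc o) j ≡ 1ℤ → ∀ i → i ≢ suc o → entry₀ M i j ≡ 0ℤ
  column-zero {j} j≢c one = AltLine-no-minus⇒zero (colLine M asm (nonzero⇒col< M one (λ ())))
                              (λ i → j≢c ∘ proj₂ ∘ minus-unique i j) one

neutral⇒shape : ∀ {n} {M : Mat n} → InA M → sign M ≡ neu → NeutralShape M
neutral⇒shape {n} {M} inA neutral with InA⇒UniqueMinusAt inA
... | i₀ , c , U =
  minus-below-first-one⇒shape (proj₁ inA) (subst (λ i → UniqueMinusAt M i c) i₀≡1+o U) before-one above
  where
  open UniqueMinusAt U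
  column : Flanked (λ i → entry₀ M i c) i₀
  column = AltLine-single-minus⇒flanked (colLine M (proj₁ inA) (nonzero⇒col< M minus-entry (λ ())))
             minus-entry (λ i → proj₁ ∘ minus-unique i c)
  open Flanked column renaming (before to o)
  above : ∀ i → i < o → entry₀ M i c ≡ 0ℤ
  above i i<o = elsewhere-zero i (ℕ.<⇒≢ i<o) (ℕ.<⇒≢ (ℕ.<-trans i<o before<p))
                  (ℕ.<⇒≢ (ℕ.<-trans i<o (ℕ.<-trans before<p p<after)))
  i₀≡1+o : i₀ ≡ suc o
  i₀≡1+o = ℕ.≤-antisym (ℕ.≤-pred (subst₂ _≤_ (closeRow≡ U) (cong suc (openRow≡ U before-one above))
                                             (neutral⇒adjacent {M = M} neutral)))
                        before<p

entry₀-mk : ∀ n (f : ℕ → ℕ → ℤ) i j → i < n → j < n → entry₀ (mk n f) i j ≡ f (suc i) (suc j)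
entry₀-mk n f i j i<n j<n
  rewrite vget-tabulate (replicate n 0ℤ) (λ ι → tabulate (λ κ → f (suc (toℕ ι)) (suc (toℕ κ)))) i i<n
        | vget-tabulate 0ℤ (λ κ → f (suc (toℕ (fromℕ< i<n))) (suc (toℕ κ))) j j<n
        | toℕ-fromℕ< i<n | toℕ-fromℕ< j<n = refl

module Mirror (n : ℕ) where

  mirror : ℕ → ℕ
  mirror j = n ∸ suc j

  n∸j≡1+mirror : ∀ {j} → j < n → n ∸ j ≡ suc (mirror j)
  n∸j≡1+mirror = ℕ.+-∸-assoc 1

  mirror-involutive : ∀ {j} → j < n → mirror (mirror j) ≡ j
  mirror-involutive j<n = trans (cong (n ∸_) (sym (n∸j≡1+mirror j<n))) (ℕ.m∸[m∸n]≡n (ℕ.<⇒≤ j<n))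

  mirror-≡ : ∀ {j x} → j < n → mirror j ≡ x → j ≡ mirror x
  mirror-≡ j<n e = trans (sym (mirror-involutive j<n)) (cong mirror e)

  mirror-< : ∀ {j} → j < n → mirror j < n
  mirror-< j<n = ℕ.∸-monoʳ-< (s≤s z≤n) j<n

  mirror-reverses : ∀ {i j} → i < j → j < n → mirror j < mirror i
  mirror-reverses i<j j<n = ℕ.∸-monoʳ-< (s≤s i<j) j<n

module _ {n} (N : Mat n) where
  open Mirror n

  entry₀-reflect : ∀ i {j} → j < n → entry₀ (reflect N) i j ≡ entry₀ N i (mirror j)
  entry₀-reflect i {j} j<n with i ℕ.<? n
  ... | yes i<n = trans (entry₀-mk n (λ r j → ent N r (suc n ∸ j)) i j i<n j<n)
                        (cong (ent N (suc i)) (n∸j≡1+mirror j<n))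
  ... | no  i≮n = trans (entry₀-row≥ (reflect N) i j (ℕ.≮⇒≥ i≮n)) (sym (entry₀-row≥ N i _ (ℕ.≮⇒≥ i≮n)))

  zero-via-reflect : ∀ i j → (j < n → entry₀ (reflect N) i (mirror j) ≡ 0ℤ) → entry₀ N i j ≡ 0ℤ
  zero-via-reflect i j zero-reflected with j ℕ.<? n
  ... | no  j≮n = entry₀-col≥ N i j (ℕ.≮⇒≥ j≮n)
  ... | yes j<n = begin
    entry₀ N i j                       ≡⟨ cong (entry₀ N i) (mirror-involutive j<n) ⟨
    entry₀ N i (mirror (mirror j))     ≡⟨ entry₀-reflect i (mirror-< j<n) ⟨
    entry₀ (reflect N) i (mirror j)    ≡⟨ zero-reflected j<n ⟩
    0ℤ                                 ∎
    where open ≡-Reasoning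

  reflect-UniqueMinusAt : ∀ {i c} → UniqueMinusAt (reflect N) i c → UniqueMinusAt N i (mirror c)
  reflect-UniqueMinusAt {i} {c} U = record
    { minus-entry  = trans (sym (entry₀-reflect i c<n)) minus-entry
    ; minus-unique = λ i′ j′ m′ → unique-mirrored i′ j′ m′ (nonzero⇒col< N m′ (λ ()))
    }
    where
    open UniqueMinusAt U
    c<n : c < n
    c<n = nonzero⇒col< (reflect N) minus-entry (λ ())
    unique-mirrored : ∀ i′ j′ → entry₀ N i′ j′ ≡ -1ℤ → j′ < n → i′ ≡ i × j′ ≡ mirror c
    unique-mirrored i′ j′ m′ j′<n
      with minus-unique i′ (mirror j′) (trans (entry₀-reflect i′ (mirror-< j′<n))
                                              (trans (cong (entry₀ N i′) (mirror-involutive j′<n)) m′))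
    ... | i′≡i , mirror-j′≡c = i′≡i , mirror-≡ j′<n mirror-j′≡c

  reflect-shape : NeutralShape (reflect N) → NeutralShape N
  reflect-shape S = record
    { o             = o
    ; c             = mirror c
    ; l             = mirror r
    ; r             = mirror l
    ; l<c           = mirror-reverses c<r r<n
    ; c<r           = mirror-reverses l<c c<n
    ; minus         = reflect-UniqueMinusAt minus
    ; opening-one   = trans (sym (entry₀-reflect o c<n)) opening-one
    ; above-opening = λ i i<o → trans (sym (entry₀-reflect i c<n)) (above-opening i i<o)
    ; opening-row   = λ j j≢c → zero-via-reflect o j λ j<n →
                        opening-row (mirror j) (j≢c ∘ mirror-≡ j<n)
    ; left-one      = trans (sym (entry₀-reflect (suc o) r<n)) right-one
    ; right-one     = trans (sym (entry₀-reflect (suc o) l<n)) left-one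
    ; closing-row   = λ j j≢l j≢c j≢r → zero-via-reflect (suc o) j λ j<n →
                        closing-row (mirror j) (j≢r ∘ mirror-≡ j<n) (j≢c ∘ mirror-≡ j<n) (j≢l ∘ mirror-≡ j<n)
    ; left-column   = λ i i≢ → trans (sym (entry₀-reflect i r<n)) (right-column i i≢)
    ; right-column  = λ i i≢ → trans (sym (entry₀-reflect i l<n)) (left-column i i≢)
    }
    where
    open NeutralShape S
    r<n : r < n
    r<n = nonzero⇒col< (reflect N) right-one (λ ())
    c<n : c < n
    c<n = ℕ.<-trans c<r r<n
    l<n : l < n
    l<n = ℕ.<-trans l<c c<n

Σℤ-++ : ∀ xs ys → Σℤ (xs ++ ys) ≡ Σℤ xs + Σℤ ys
Σℤ-++ []       ys = sym (ℤ.+-identityˡ (Σℤ ys))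
Σℤ-++ (x ∷ xs) ys = trans (cong (_+_ x) (Σℤ-++ xs ys)) (sym (ℤ.+-assoc x (Σℤ xs) (Σℤ ys)))

Σℤ-concatMap : ∀ {A : Set} (g : A → List ℤ) xs → Σℤ (concatMap g xs) ≡ Σℤ (map (Σℤ ∘ g) xs)
Σℤ-concatMap g []       = refl
Σℤ-concatMap g (x ∷ xs) = trans (Σℤ-++ (g x) (concatMap g xs)) (cong (_+_ (Σℤ (g x))) (Σℤ-concatMap g xs))

Σℤ-map-+ : ∀ {A : Set} (f g : A → ℤ) xs → Σℤ (map (λ x → f x + g x) xs) ≡ Σℤ (map f xs) + Σℤ (map g xs)
Σℤ-map-+ f g []       = refl
Σℤ-map-+ f g (x ∷ xs) =
  trans (cong (_+_ (f x + g x)) (Σℤ-map-+ f g xs)) (interchange (f x) (g x) (Σℤ (map f xs)) (Σℤ (map g xs)))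

Σℤ-map-zero : ∀ {A : Set} (f : A → ℤ) xs → (∀ x → x ∈ xs → f x ≡ 0ℤ) → Σℤ (map f xs) ≡ 0ℤ
Σℤ-map-zero f []       _    = refl
Σℤ-map-zero f (x ∷ xs) vanish rewrite vanish x (here refl) =
  trans (ℤ.+-identityˡ _) (Σℤ-map-zero f xs (λ y → vanish y ∘ there))

segSum : (ℕ → ℤ) → ℕ → ℕ → ℤ
segSum f a b = Σℤ (map f (rng a b))

module _ (f : ℕ → ℤ) where

  segSum-∷ : ∀ {a b} → a ≤ b → segSum f a b ≡ f a + segSum f (suc a) b
  segSum-∷ a≤b = cong (Σℤ ∘ map f) (rng-∷ a≤b)

  segSum-++ : ∀ {a m b} → a ≤ suc m → m ≤ b → segSum f a b ≡ segSum f a m + segSum f (suc m) b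
  segSum-++ {a} {m} {b} a≤1+m m≤b = begin
    Σℤ (map f (rng a b))                               ≡⟨ cong (Σℤ ∘ map f) (rng-++ a≤1+m m≤b) ⟩
    Σℤ (map f (rng a m ++ rng (suc m) b))              ≡⟨ cong Σℤ (map-++ f (rng a m) (rng (suc m) b)) ⟩
    Σℤ (map f (rng a m) ++ map f (rng (suc m) b))      ≡⟨ Σℤ-++ (map f (rng a m)) (map f (rng (suc m) b)) ⟩
    segSum f a m + segSum f (suc m) b                  ∎
    where open ≡-Reasoning

  segSum-zero : ∀ {a b} → (∀ j → a ≤ j → j ≤ b → f j ≡ 0ℤ) → segSum f a b ≡ 0ℤ
  segSum-zero vanish = Σℤ-map-zero f _ (λ j j∈ → vanish j (proj₁ (∈-rng⁻ j∈)) (proj₂ (∈-rng⁻ j∈)))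

  segSum-single : ∀ {a x b} → a ≤ suc x → suc x ≤ b →
    (∀ j → a ≤ j → j ≤ b → j ≢ suc x → f j ≡ 0ℤ) → segSum f a b ≡ f (suc x)
  segSum-single {a} {x} {b} a≤1+x 1+x≤b vanish = begin
    segSum f a b                                        ≡⟨ segSum-++ a≤1+x (ℕ.<⇒≤ 1+x≤b) ⟩
    segSum f a x + segSum f (suc x) b                   ≡⟨ cong₂ _+_ left (segSum-∷ 1+x≤b) ⟩
    0ℤ + (f (suc x) + segSum f (suc (suc x)) b)         ≡⟨ cong (λ s → 0ℤ + (f (suc x) + s)) right ⟩
    0ℤ + (f (suc x) + 0ℤ)                               ≡⟨ ℤ.+-identityˡ _ ⟩
    f (suc x) + 0ℤ                                      ≡⟨ ℤ.+-identityʳ _ ⟩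
    f (suc x)                                           ∎
    where
    open ≡-Reasoning
    left : segSum f a x ≡ 0ℤ
    left = segSum-zero λ j a≤j j≤x →
      vanish j a≤j (ℕ.≤-trans j≤x (ℕ.<⇒≤ (ℕ.<-≤-trans (ℕ.n<1+n x) 1+x≤b))) (ℕ.<⇒≢ (s≤s j≤x))
    right : segSum f (suc (suc x)) b ≡ 0ℤ
    right = segSum-zero λ j x+2≤j j≤b →
      vanish j (ℕ.≤-trans a≤1+x (ℕ.<⇒≤ x+2≤j)) j≤b (ℕ.>⇒≢ x+2≤j)

module _ {n} (M : Mat n) where

  boxSum≡segSum : ∀ r₁ r₂ c₁ c₂ → boxSum M r₁ r₂ c₁ c₂ ≡ segSum (λ i → segSum (ent M i) c₁ c₂) r₁ r₂
  boxSum≡segSum r₁ r₂ c₁ c₂ = Σℤ-concatMap (λ i → map (ent M i) (rng c₁ c₂)) (rng r₁ r₂)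

  boxSum-∷ : ∀ {r₁ r₂} c₁ c₂ → r₁ ≤ r₂ →
    boxSum M r₁ r₂ c₁ c₂ ≡ segSum (ent M r₁) c₁ c₂ + boxSum M (suc r₁) r₂ c₁ c₂
  boxSum-∷ {r₁} {r₂} c₁ c₂ r₁≤r₂ =
    trans (boxSum≡segSum r₁ r₂ c₁ c₂)
          (trans (segSum-∷ _ r₁≤r₂) (cong (_+_ (segSum (ent M r₁) c₁ c₂)) (sym (boxSum≡segSum (suc r₁) r₂ c₁ c₂))))

  boxSum-++ : ∀ r₁ r₂ {c₁ m c₂} → c₁ ≤ suc m → m ≤ c₂ →
    boxSum M r₁ r₂ c₁ c₂ ≡ boxSum M r₁ r₂ c₁ m + boxSum M r₁ r₂ (suc m) c₂
  boxSum-++ r₁ r₂ {c₁} {m} {c₂} c₁≤1+m m≤c₂ = begin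
    boxSum M r₁ r₂ c₁ c₂
      ≡⟨ boxSum≡segSum r₁ r₂ c₁ c₂ ⟩
    Σℤ (map (λ i → segSum (ent M i) c₁ c₂) (rng r₁ r₂))
      ≡⟨ cong Σℤ (map-cong (λ i → segSum-++ (ent M i) c₁≤1+m m≤c₂) (rng r₁ r₂)) ⟩
    Σℤ (map (λ i → segSum (ent M i) c₁ m + segSum (ent M i) (suc m) c₂) (rng r₁ r₂))
      ≡⟨ Σℤ-map-+ (λ i → segSum (ent M i) c₁ m) (λ i → segSum (ent M i) (suc m) c₂) (rng r₁ r₂) ⟩
    Σℤ (map (λ i → segSum (ent M i) c₁ m) (rng r₁ r₂)) + Σℤ (map (λ i → segSum (ent M i) (suc m) c₂) (rng r₁ r₂))
      ≡⟨ cong₂ _+_ (boxSum≡segSum r₁ r₂ c₁ m) (boxSum≡segSum r₁ r₂ (suc m) c₂) ⟨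
    boxSum M r₁ r₂ c₁ m + boxSum M r₁ r₂ (suc m) c₂
      ∎
    where open ≡-Reasoning

  boxSum-zero : ∀ r₁ r₂ c₁ c₂ → (∀ i j → r₁ ≤ i → i ≤ r₂ → c₁ ≤ j → j ≤ c₂ → ent M i j ≡ 0ℤ) →
    boxSum M r₁ r₂ c₁ c₂ ≡ 0ℤ
  boxSum-zero r₁ r₂ c₁ c₂ vanish = trans (boxSum≡segSum r₁ r₂ c₁ c₂)
    (segSum-zero _ λ i r₁≤i i≤r₂ → segSum-zero _ λ j c₁≤j j≤c₂ → vanish i j r₁≤i i≤r₂ c₁≤j j≤c₂)

aAt-genTable : ∀ {n} (N : Mat n) E i → i < n →
  aAt (GIT.a (genTable N E)) (n ∸ i) ≡ boxSum N (suc (suc i)) n 1 (oneCol N (suc i) ∸ 1)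
aAt-genTable {n} N E i i<n = begin
  aAt a (n ∸ i)                  ≡⟨ cong (aAt a) (ℕ.+-∸-assoc 1 i<n) ⟩
  vget 0ℤ a (n ∸ suc i)          ≡⟨ vget-tabulate 0ℤ _ (n ∸ suc i) n∸1+i<n ⟩
  aEntry N (suc (toℕ (fromℕ< n∸1+i<n))) ≡⟨ cong (aEntry N ∘ suc) (toℕ-fromℕ< n∸1+i<n) ⟩
  aEntry N (suc (n ∸ suc i))     ≡⟨ cong (λ r → boxSum N (suc r) n 1 (oneCol N r ∸ 1)) row ⟩
  boxSum N (suc (suc i)) n 1 (oneCol N (suc i) ∸ 1) ∎
  where
  open ≡-Reasoning
  a = GIT.a (genTable N E)
  n∸1+i<n : n ∸ suc i < n
  n∸1+i<n = ℕ.∸-monoʳ-< (s≤s z≤n) i<n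
  row : n ∸ (n ∸ suc i) ≡ suc i
  row = ℕ.m∸[m∸n]≡n i<n

module _ {n} {N : Mat n} (S : NeutralShape N) where
  open NeutralShape S

  private
    closing<n : suc o < n
    closing<n = nonzero⇒row< N (UniqueMinusAt.minus-entry minus) (λ ())
    c<n : c < n
    c<n = nonzero⇒col< N opening-one (λ ())
    l<n : l < n
    l<n = ℕ.<-trans l<c c<n
    left-of-leading : ∀ j → j < l → entry₀ N (suc o) j ≡ 0ℤ
    left-of-leading j j<l = closing-row j (ℕ.<⇒≢ j<l) (ℕ.<⇒≢ (ℕ.<-trans j<l l<c))
                              (ℕ.<⇒≢ (ℕ.<-trans j<l (ℕ.<-trans l<c c<r)))

  openRow-shape : openRow N ≡ suc o
  openRow-shape = openRow≡ minus opening-one above-opening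

  leadRow-shape : leadRow N ≡ suc (suc o)
  leadRow-shape rewrite openRow-shape | openCol≡ minus =
    firstℕ-rng _ ℕ.≤-refl closing<n (any-true _ (∈-rng⁺ (s≤s z≤n) l<c) (==-true left-one))
      (λ z o+2≤z z<o+2 → ⊥-elim (ℕ.<⇒≱ z<o+2 o+2≤z))

  leadCol-shape : leadCol N ≡ suc l
  leadCol-shape rewrite leadRow-shape | openCol≡ minus = firstOneInRow l<c left-one left-of-leading

  ℓval-shape : ℓval N ≡ boxSum N (suc (suc o)) n (suc (suc l)) c
  ℓval-shape = begin
    boxSum N (suc (openRow N)) n (suc (leadCol N)) (openCol N ∸ 1)
      ≡⟨ cong₂ (λ i j → boxSum N (suc i) n (suc j) (openCol N ∸ 1)) openRow-shape leadCol-shape ⟩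
    boxSum N (suc (suc o)) n (suc (suc l)) (openCol N ∸ 1)
      ≡⟨ cong (λ j → boxSum N (suc (suc o)) n (suc (suc l)) (j ∸ 1)) (openCol≡ minus) ⟩
    boxSum N (suc (suc o)) n (suc (suc l)) c ∎
    where open ≡-Reasoning

  opening-region-split : boxSum N (suc (suc o)) n 1 c
    ≡ boxSum N (suc (suc (suc o))) n 1 l + 1ℤ + boxSum N (suc (suc o)) n (suc (suc l)) c
  opening-region-split = begin
    boxSum N (suc (suc o)) n 1 c
      ≡⟨ boxSum-∷ N 1 c closing<n ⟩
    segSum (ent N (suc (suc o))) 1 c + below 1 c
      ≡⟨ cong₂ _+_ leading-one (boxSum-++ N (suc (suc (suc o))) n (s≤s z≤n) (ℕ.<⇒≤ l<c)) ⟩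
    1ℤ + (Y + below (suc l) c)
      ≡⟨ cong (λ s → 1ℤ + (Y + s)) (boxSum-++ N (suc (suc (suc o))) n (ℕ.n≤1+n (suc l)) l<c) ⟩
    1ℤ + (Y + (below (suc l) (suc l) + Z))
      ≡⟨ cong (λ s → 1ℤ + (Y + (s + Z))) leading-column ⟩
    1ℤ + (Y + (0ℤ + Z))
      ≡⟨ regroup Y (0ℤ + Z) ⟩
    Y + 1ℤ + (0ℤ + Z)
      ≡⟨ cong (_+_ (Y + 1ℤ)) ℓ-region ⟨
    Y + 1ℤ + boxSum N (suc (suc o)) n (suc (suc l)) c
      ∎
    where
    open ≡-Reasoning
    open +-*-Solver
    below : ℕ → ℕ → ℤ
    below = boxSum N (suc (suc (suc o))) n
    Y = below 1 l
    Z = below (suc (suc l)) c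
    leading-one : segSum (ent N (suc (suc o))) 1 c ≡ 1ℤ
    leading-one = trans (segSum-single _ (s≤s z≤n) l<c λ where
      (suc j) _ j<c 1+j≢1+l → closing-row j (1+j≢1+l ∘ cong suc) (ℕ.<⇒≢ j<c) (ℕ.<⇒≢ (ℕ.<-trans j<c c<r)))
      left-one
    leading-column : below (suc l) (suc l) ≡ 0ℤ
    leading-column = boxSum-zero N (suc (suc (suc o))) n (suc l) (suc l) λ where
      (suc i) (suc j) (s≤s o+2≤i) _ (s≤s l≤j) (s≤s j≤l) →
        trans (cong (entry₀ N i) (ℕ.≤-antisym j≤l l≤j)) (left-column i (ℕ.>⇒≢ o+2≤i))
    ℓ-region : boxSum N (suc (suc o)) n (suc (suc l)) c ≡ 0ℤ + Z
    ℓ-region = trans (boxSum-∷ N (suc (suc l)) c closing<n) (cong (_+ Z) right-of-leading)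
      where
      right-of-leading : segSum (ent N (suc (suc o))) (suc (suc l)) c ≡ 0ℤ
      right-of-leading = segSum-zero (ent N (suc (suc o))) {suc (suc l)} {c} λ where
        (suc j) (s≤s l<j) j<c → closing-row j (ℕ.>⇒≢ l<j) (ℕ.<⇒≢ j<c) (ℕ.<⇒≢ (ℕ.<-trans j<c c<r))
    regroup : ∀ y z → 1ℤ + (y + z) ≡ y + 1ℤ + z
    regroup = solve 2 (λ y z → con 1ℤ :+ (y :+ z) := y :+ con 1ℤ :+ z) refl

  genTable-aₖ≡aₖ₋₁+1+ℓ : ∀ E → let T = genTable N E in
    aAt (GIT.a T) (GIT.k T) ≡ aAt (GIT.a T) (GIT.k T ∸ 1) + 1ℤ + ℓval N
  genTable-aₖ≡aₖ₋₁+1+ℓ E = begin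
    aAt a (suc n ∸ openRow N)
      ≡⟨ cong (λ r → aAt a (suc n ∸ r)) openRow-shape ⟩
    aAt a (n ∸ o)
      ≡⟨ aAt-genTable N E o o<n ⟩
    boxSum N (suc (suc o)) n 1 (oneCol N (suc o) ∸ 1)
      ≡⟨ cong (λ x → boxSum N (suc (suc o)) n 1 (x ∸ 1)) opening-oneCol ⟩
    boxSum N (suc (suc o)) n 1 c
      ≡⟨ opening-region-split ⟩
    boxSum N (suc (suc (suc o))) n 1 l + 1ℤ + boxSum N (suc (suc o)) n (suc (suc l)) c
      ≡⟨ cong₂ (λ y L → y + 1ℤ + L) closing-entry ℓval-shape ⟨
    aAt a (suc n ∸ openRow N ∸ 1) + 1ℤ + ℓval N
      ∎
    where
    open ≡-Reasoning
    a = GIT.a (genTable N E)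
    o<n : o < n
    o<n = ℕ.<-trans (ℕ.n<1+n o) closing<n
    opening-oneCol : oneCol N (suc o) ≡ suc c
    opening-oneCol = firstOneInRow c<n opening-one (λ j → opening-row j ∘ ℕ.<⇒≢)
    closing-entry : aAt a (suc n ∸ openRow N ∸ 1) ≡ boxSum N (suc (suc (suc o))) n 1 l
    closing-entry = begin
      aAt a (suc n ∸ openRow N ∸ 1)
        ≡⟨ cong (λ r → aAt a (suc n ∸ r ∸ 1)) openRow-shape ⟩
      aAt a (n ∸ o ∸ 1)
        ≡⟨ cong (λ k → aAt a (k ∸ 1)) (ℕ.+-∸-assoc 1 o<n) ⟩
      aAt a (n ∸ suc o)
        ≡⟨ aAt-genTable N E (suc o) closing<n ⟩
      boxSum N (suc (suc (suc o))) n 1 (oneCol N (suc (suc o)) ∸ 1)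
        ≡⟨ cong (λ x → boxSum N (suc (suc (suc o))) n 1 (x ∸ 1)) (firstOneInRow l<n left-one left-of-leading) ⟩
      boxSum N (suc (suc (suc o))) n 1 l
        ∎

  genTable-β′ : ∀ E → let T = genTable N E in
    GIT.β (genTable N (cval N - ℓval N - E))
      ≡ GIT.b T - GIT.β T + aAt (GIT.a T) (GIT.k T) - aAt (GIT.a T) (GIT.k T ∸ 1) - 1ℤ
  genTable-β′ E rewrite genTable-aₖ≡aₖ₋₁+1+ℓ E =
    solve 4 (λ C L E Y → C :- L :- E :+ L := C :- (E :+ L) :+ (Y :+ con 1ℤ :+ L) :- Y :- con 1ℤ) refl
      (cval N) (ℓval N) E (aAt (GIT.a (genTable N E)) (GIT.k (genTable N E) ∸ 1))
    where open +-*-Solver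

Λ⇒shape : ∀ s {n} {A N : Mat n} {E} → lamBy s A N E → NeutralShape N
Λ⇒shape pos         (inA , neutral , _) = neutral⇒shape inA neutral
Λ⇒shape neu         (inA , neutral , _) = neutral⇒shape inA neutral
Λ⇒shape neg {N = N} (inA , neutral , _) = reflect-shape N (neutral⇒shape inA neutral)

mainTheorem9 : (n : ℕ) (A N : Mat n) (E : ℤ) → InA A → Lam A N E →
    (A' : Mat n) → InA A' → Lam A' N (cval N - ℓval N - E) →
    genTable N (cval N - ℓval N - E)
      ≡ git (GIT.k (genTable N E)) (GIT.a (genTable N E)) (GIT.b (genTable N E))
            (GIT.b (genTable N E) - GIT.β (genTable N E)
              + aAt (GIT.a (genTable N E)) (GIT.k (genTable N E))
              - aAt (GIT.a (genTable N E)) (GIT.k (genTable N E) ∸ 1)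
              - 1ℤ)
-- Only Λ(A) = (N , E) is needed: the table of (N , E′) depends on E′ only through β.
mainTheorem9 n A N E _ ΛA _ _ _ = cong (git _ _ _) (genTable-β′ (Λ⇒shape (sign A) ΛA) E)
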